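{- Let $d\geq 1$ and $2\leq n_1\leq n_2\leq\cdots\leq n_d$ be integers, and let $G=K_{n_1}\times K_{n_2}\times\cdots\times K_{n_d}$. Then $\sigma_T(G)\leq 2d-1$ if $n_1=2$, and $\sigma_T(G)\leq 2d$ if $n_1\geq 3$.
   Context: $K_n$ is the complete graph on $n$ vertices and $\times$ is the Cartesian product of graphs: $V(G\times H)=V(G)\times V(H)$, and $(u,v)\sim(u',v')$ iff either $u=u'$ and $vv'\in E(H)$, or $v=v'$ and $uu'\in E(G)$. Thus the vertices of $G$ are vectors $(x_1,\ldots,x_d)$ with $x_i\in\{0,\ldots,n_i-1\}$, adjacent iff they differ in exactly one coordinate. For a spanning tree $T$ of a connected graph $G$, $d_T(u,v)$ denotes the distance in $T$, $\sigma_T(G,T):=\max_{uv\in E(G)} d_T(u,v)$, and the tree-stretch of $G$ is $\sigma_T(G):=\min\{\sigma_T(G,T): T \text{ a spanning tree of } G\}$. -}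

module Defs where

open import Data.Nat using (ℕ; zero; suc; _<_; _≤_)
open import Data.Fin using (Fin)
open import Data.Vec using (Vec; lookup)
open import Data.Vec.Relation.Binary.Pointwise.Inductive using (Pointwise)
open import Data.List using (List; []; _∷_; length)
open import Data.List.Relation.Unary.Unique.Propositional using (Unique)
open import Data.Product using (Σ; ∃; _×_; _,_; proj₁)
open import Relation.Nullary using (¬_)
open import Data.Empty using (⊥)
open import Relation.Binary.PropositionalEquality using (_≡_; _≢_)

data Walk {V : Set} (R : V → V → Set) : V → V → ℕ → Set where
  nil  : ∀ {u} → Walk R u u 0
  cons : ∀ {u w v k} → R u w → Walk R w v k → Walk R u v (suc k)

DistAtMost : {V : Set} → (V → V → Set) → V → V → ℕ → Set
DistAtMost R u v k = Σ ℕ λ m → m ≤ k × Walk R u v m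

ClosedChain : {V : Set} → (V → V → Set) → V → List V → Set
ClosedChain R first []           = ⊥
ClosedChain R first (x ∷ [])     = R x first
ClosedChain R first (x ∷ y ∷ xs) = R x y × ClosedChain R first (y ∷ xs)

Cycle : {V : Set} → (V → V → Set) → List V → Set
Cycle R []       = ⊥
Cycle R (v ∷ vs) = 3 ≤ length (v ∷ vs) × Unique (v ∷ vs) × ClosedChain R v (v ∷ vs)

Connected : {V : Set} → (V → V → Set) → Set
Connected {V} R = (u v : V) → Σ ℕ λ k → Walk R u v k

Acyclic : {V : Set} → (V → V → Set) → Set
Acyclic {V} R = (c : List V) → ¬ Cycle R c

record SpanningTree {V : Set} (Adj : V → V → Set) (T : V → V → Set) : Set where
  field
    sub       : ∀ {u v} → T u v → Adj u v
    symmetric : ∀ {u v} → T u v → T v u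
    connected : Connected T
    acyclic   : Acyclic T

StretchAtMost : {V : Set} → (V → V → Set) → (V → V → Set) → ℕ → Set
StretchAtMost {V} Adj T k = ∀ (u v : V) → Adj u v → DistAtMost T u v k

-- σ_T(G) ≤ k : some spanning tree T has σ_T(G,T) ≤ k
-- (σ_T(G) is a minimum over the nonempty finite set of spanning trees)
TreeStretchAtMost : {V : Set} → (V → V → Set) → ℕ → Set₁
TreeStretchAtMost {V} Adj k =
  Σ (V → V → Set) λ T → SpanningTree Adj T × StretchAtMost Adj T k

HVertex : ∀ {d} → Vec ℕ d → Set
HVertex {d} ns = Σ (Vec ℕ d) λ x → Pointwise _<_ x ns

HAdj : ∀ {d} (ns : Vec ℕ d) → HVertex ns → HVertex ns → Set
HAdj {d} ns (x , _) (y , _) =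
  Σ (Fin d) λ i → lookup x i ≢ lookup y i × (∀ j → j ≢ i → lookup x j ≡ lookup y j)

module Submission where

-- Root the tree at the all-zero vertex and let the parent of a nonzero
-- vertex x be x with its LAST nonzero coordinate reset to 0.  The tree is
-- the symmetric closure of this parent relation; every parent step changes
-- one coordinate, so it is a subgraph of G.
--
-- 1. Walks: concatenation, reversal, images under graph homomorphisms.
-- 2. Parent forests: if each vertex has at most one parent and parents
--    have strictly smaller rank, the symmetric closure has no cycle.
-- 3. The Hamming tree: rank = weight (number of nonzero coordinates);
--    the tree path from x to the root has length weight x ≤ d, so the
--    tree is connected, hence a spanning tree.
-- 4. Stretch: an edge changing a later coordinate lifts from the tree of
--    K_{n_2} × ⋯ × K_{n_d}; an edge (a,x)(b,x) changing the first
--    coordinate closes up through the root with length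
--    weight (a,x) + weight (b,x) ≤ 2d, and ≤ 2d - 1 when n_1 = 2, since
--    then one of a, b is 0.  Induction on d gives the theorem.

open import Defs
open import Data.Nat using (ℕ; zero; suc; _≤_; _<_; _*_; _∸_; _+_; z≤n; s≤s)
open import Data.Nat.Properties
open import Data.Fin using (Fin) renaming (zero to fzero; suc to fsuc; _≤_ to _≤ᶠ_)
open import Data.Fin.Properties using () renaming (suc-injective to fsuc-injective)
open import Data.Vec using (Vec; lookup; []; _∷_)
open import Data.Vec.Relation.Binary.Pointwise.Inductive using (Pointwise; []; _∷_)
import Data.Vec.Relation.Binary.Pointwise.Extensional as Extensional
open import Data.List using (List; []; _∷_)
open import Data.List.Relation.Unary.All using (All; _∷_)
open import Data.List.Relation.Unary.Unique.Propositional using (Unique)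
open import Data.List.Relation.Unary.AllPairs using (_∷_)
open import Data.Product using (Σ; _×_; _,_; proj₁)
open import Data.Sum using (_⊎_; inj₁; inj₂)
open import Data.Empty using (⊥-elim)
open import Function using (_∘_)
open import Relation.Nullary using (¬_)
open import Relation.Binary.PropositionalEquality

-- 1. Walks and distances in an arbitrary relation

module _ {V : Set} {R : V → V → Set} where

  snocʷ : ∀ {u v w k} → Walk R u v k → R v w → Walk R u w (suc k)
  snocʷ nil         r = cons r nil
  snocʷ (cons r′ w) r = cons r′ (snocʷ w r)

  _++ʷ_ : ∀ {u v w k m} → Walk R u v k → Walk R v w m → Walk R u w (k + m)
  nil      ++ʷ w′ = w′
  cons r w ++ʷ w′ = cons r (w ++ʷ w′)

  reverseʷ : (∀ {x y} → R x y → R y x) → ∀ {u v k} → Walk R u v k → Walk R v u k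
  reverseʷ R-sym nil        = nil
  reverseʷ R-sym (cons r w) = snocʷ (reverseʷ R-sym w) (R-sym r)

  walk-via : (∀ {x y} → R x y → R y x) → ∀ {u v w k m}
    → Walk R u w k → Walk R v w m → Walk R u v (k + m)
  walk-via R-sym wu wv = wu ++ʷ reverseʷ R-sym wv

  dist-via : (∀ {x y} → R x y → R y x) → ∀ {u v w k m}
    → Walk R u w k → Walk R v w m → DistAtMost R u v (k + m)
  dist-via R-sym wu wv = _ , ≤-refl , walk-via R-sym wu wv

  dist-weaken : ∀ {u v k m} → k ≤ m → DistAtMost R u v k → DistAtMost R u v m
  dist-weaken k≤m (j , j≤k , w) = j , ≤-trans j≤k k≤m , w

module _ {V W : Set} {R : V → V → Set} {S : W → W → Set} (f : V → W)
         (hom : ∀ {x y} → R x y → S (f x) (f y)) where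

  mapʷ : ∀ {u v k} → Walk R u v k → Walk S (f u) (f v) k
  mapʷ nil        = nil
  mapʷ (cons r w) = cons (hom r) (mapʷ w)

  map-dist : ∀ {u v k} → DistAtMost R u v k → DistAtMost S (f u) (f v) k
  map-dist (j , j≤k , w) = j , j≤k , mapʷ w

stretch-weaken : ∀ {V : Set} {Adj T : V → V → Set} {k m}
  → k ≤ m → StretchAtMost Adj T k → StretchAtMost Adj T m
stretch-weaken k≤m stretch u v uv = dist-weaken k≤m (stretch u v uv)

-- 2. Parent forests are acyclic

SymClosure : {V : Set} → (V → V → Set) → V → V → Set
SymClosure P u v = P u v ⊎ P v u

symClosure-sym : {V : Set} {P : V → V → Set} {u v : V}
  → SymClosure P u v → SymClosure P v u
symClosure-sym (inj₁ p) = inj₂ p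
symClosure-sym (inj₂ p) = inj₁ p

-- Parent u v means "v is the parent of u".  A path a, as…, t is
-- represented, as in the definition of Cycle, by ClosedChain T t (a ∷ as).
module ParentForest {V : Set} (Parent : V → V → Set) (rank : V → ℕ)
  (parent-unique : ∀ {u v w} → Parent u v → Parent u w → v ≡ w)
  (parent-rank : ∀ {u v} → Parent u v → rank v < rank u) where

  private
    T : V → V → Set
    T = SymClosure Parent

  -- The vertex following the start a of the path a, as…, t.
  second : List V → V → V
  second []      t = t
  second (b ∷ _) t = b

  -- The vertex preceding the end t of the path a, as…, t.
  penultimate : V → List V → V
  penultimate a []       = a
  penultimate _ (b ∷ bs) = penultimate b bs

  second-≢ : ∀ {x t} bs → x ≢ t → All (x ≢_) bs → x ≢ second bs t
  second-≢ []      x≢t _           = x≢t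
  second-≢ (b ∷ _) _   (x≢b ∷ _)   = x≢b

  penultimate-≢ : ∀ {x} b bs → All (x ≢_) (b ∷ bs) → x ≢ penultimate b bs
  penultimate-≢ b []       (x≢b ∷ _)  = x≢b
  penultimate-≢ b (c ∷ cs) (_ ∷ x≢cs) = penultimate-≢ c cs x≢cs

  -- Along a path of distinct vertices, once a step goes down to a child
  -- the next step cannot go up (that would be a second parent), so the path
  -- keeps descending.
  climbs-or-rises : ∀ t a as → ClosedChain T t (a ∷ as) → Unique (t ∷ a ∷ as)
    → Parent a (second as t) ⊎ rank a < rank t
  climbs-or-rises t a []       (inj₁ up)   _ = inj₁ up
  climbs-or-rises t a []       (inj₂ down) _ = inj₂ (parent-rank down)
  climbs-or-rises t a (b ∷ bs) (inj₁ up , _) _ = inj₁ up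
  climbs-or-rises t a (b ∷ bs) (inj₂ down , chain) ((t≢a ∷ t∉bs) ∷ (_ ∷ a∉bs) ∷ rest)
    with climbs-or-rises t b bs chain (t∉bs ∷ rest)
  ... | inj₁ up = ⊥-elim (second-≢ bs (t≢a ∘ sym) a∉bs (parent-unique down up))
  ... | inj₂ b<t = inj₂ (<-trans (parent-rank down) b<t)

  descends-or-falls : ∀ t a as → ClosedChain T t (a ∷ as) → Unique (t ∷ a ∷ as)
    → Parent t (penultimate a as) ⊎ rank t < rank a
  descends-or-falls t a []       (inj₁ up)   _ = inj₂ (parent-rank up)
  descends-or-falls t a []       (inj₂ down) _ = inj₁ down
  descends-or-falls t a (b ∷ bs) (step , chain) ((t≢a ∷ t∉bs) ∷ (_ ∷ a∉bs) ∷ rest)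
    with descends-or-falls t b bs chain (t∉bs ∷ rest) | step
  ... | inj₁ down | _       = inj₁ down
  ... | inj₂ t<b  | inj₁ up = inj₂ (<-trans t<b (parent-rank up))
  ... | inj₂ t<b  | inj₂ down with climbs-or-rises t b bs chain (t∉bs ∷ rest)
  ...   | inj₁ up  = ⊥-elim (second-≢ bs (t≢a ∘ sym) a∉bs (parent-unique down up))
  ...   | inj₂ b<t = ⊥-elim (<-asym t<b b<t)

  -- Cut a cycle y₀ y₁ y₂ … at y₀ to get a path y₁ y₂ … y₀.  If the edge
  -- y₀y₁ climbs, the path cannot fall in rank, so it ends by descending
  -- from the parent y₁ of y₀, i.e. it revisits y₁.  If the edge descends,
  -- the path cannot rise in rank, so it starts by climbing from y₁ to its
  -- parent y₀, i.e. y₂ = y₀.  Both contradict distinctness.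
  acyclic : Acyclic T
  acyclic []                      ()
  acyclic (_ ∷ [])                (s≤s () , _)
  acyclic (_ ∷ _ ∷ [])            (s≤s (s≤s ()) , _)
  acyclic (y₀ ∷ y₁ ∷ y₂ ∷ ys) (_ , u@(_ ∷ y₁∉rest ∷ _) , inj₁ up , chain)
    with descends-or-falls y₀ y₁ (y₂ ∷ ys) chain u
  ... | inj₁ down  = penultimate-≢ y₂ ys y₁∉rest (parent-unique up down)
  ... | inj₂ y₀<y₁ = <-asym y₀<y₁ (parent-rank up)
  acyclic (y₀ ∷ y₁ ∷ y₂ ∷ ys) (_ , u@((_ ∷ y₀≢y₂ ∷ _) ∷ _) , inj₂ down , chain)
    with climbs-or-rises y₀ y₁ (y₂ ∷ ys) chain u
  ... | inj₁ up    = y₀≢y₂ (parent-unique down up)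
  ... | inj₂ y₁<y₀ = <-asym y₁<y₀ (parent-rank down)

-- 3. The Hamming tree

zeros : ∀ {d} → Vec ℕ d
zeros {zero}  = []
zeros {suc d} = 0 ∷ zeros

-- Parent x y: y is x with its last nonzero coordinate reset to 0.
data Parent : ∀ {d} → Vec ℕ d → Vec ℕ d → Set where
  keep-head  : ∀ {d a} {xs ys : Vec ℕ d} → Parent xs ys → Parent (a ∷ xs) (a ∷ ys)
  clear-head : ∀ {d a} → Parent {suc d} (suc a ∷ zeros) (0 ∷ zeros)

-- The number of nonzero coordinates; it is the depth in the tree.
weight : ∀ {d} → Vec ℕ d → ℕ
weight []           = 0
weight (zero  ∷ xs) = weight xs
weight (suc _ ∷ xs) = suc (weight xs)

weight≤length : ∀ {d} (xs : Vec ℕ d) → weight xs ≤ d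
weight≤length []           = z≤n
weight≤length (zero  ∷ xs) = m≤n⇒m≤1+n (weight≤length xs)
weight≤length (suc _ ∷ xs) = s≤s (weight≤length xs)

-- The root has no parent; this separates the two constructors of Parent.
root-has-no-parent : ∀ {d} {y : Vec ℕ d} → ¬ Parent zeros y
root-has-no-parent {suc d} (keep-head p) = root-has-no-parent p

parent-unique : ∀ {d} {x y z : Vec ℕ d} → Parent x y → Parent x z → y ≡ z
parent-unique (keep-head p) (keep-head q) = cong (_ ∷_) (parent-unique p q)
parent-unique clear-head    clear-head    = refl
parent-unique (keep-head p) clear-head    = ⊥-elim (root-has-no-parent p)
parent-unique clear-head    (keep-head q) = ⊥-elim (root-has-no-parent q)

parent-weight : ∀ {d} {x y : Vec ℕ d} → Parent x y → weight y < weight x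
parent-weight (keep-head {a = zero}  p) = parent-weight p
parent-weight (keep-head {a = suc _} p) = s≤s (parent-weight p)
parent-weight clear-head                = n<1+n _

parent-adjacent : ∀ {d} {x y : Vec ℕ d} → Parent x y →
  Σ (Fin d) λ i → lookup x i ≢ lookup y i × (∀ j → j ≢ i → lookup x j ≡ lookup y j)
parent-adjacent (keep-head p) with parent-adjacent p
... | i , xi≢yi , same = fsuc i , xi≢yi , λ
  { fzero    _   → refl
  ; (fsuc j) j≢i → same j (j≢i ∘ cong fsuc) }
parent-adjacent clear-head = fzero , (λ ()) , λ
  { fzero    0≢0 → ⊥-elim (0≢0 refl)
  ; (fsuc j) _   → refl }

hadj-sym : ∀ {d} (ns : Vec ℕ d) {u v : HVertex ns} → HAdj ns u v → HAdj ns v u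
hadj-sym ns (i , ui≢vi , same) = i , ui≢vi ∘ sym , λ j j≢i → sym (same j j≢i)

pointwise-irrelevant : ∀ {d} {xs ns : Vec ℕ d} (p q : Pointwise _<_ xs ns) → p ≡ q
pointwise-irrelevant []       []       = refl
pointwise-irrelevant (p ∷ ps) (q ∷ qs) = cong₂ _∷_ (<-irrelevant p q) (pointwise-irrelevant ps qs)

vertex-≡ : ∀ {d} {ns : Vec ℕ d} {u v : HVertex ns} → proj₁ u ≡ proj₁ v → u ≡ v
vertex-≡ {u = x , p} {v = .x , q} refl = cong (x ,_) (pointwise-irrelevant p q)

module _ {d : ℕ} (ns : Vec ℕ d) where

  ParentV : HVertex ns → HVertex ns → Set
  ParentV u v = Parent (proj₁ u) (proj₁ v)

  Tree : HVertex ns → HVertex ns → Set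
  Tree = SymClosure ParentV

  tree-acyclic : Acyclic Tree
  tree-acyclic = ParentForest.acyclic ParentV (weight ∘ proj₁)
    (λ p q → vertex-≡ (parent-unique p q)) parent-weight

  tree-sym : ∀ {u v} → Tree u v → Tree v u
  tree-sym {u} {v} = symClosure-sym {P = ParentV} {u} {v}

  tree-sub : ∀ {u v} → Tree u v → HAdj ns u v
  tree-sub (inj₁ p) = parent-adjacent p
  tree-sub {u} {v} (inj₂ p) = hadj-sym ns {v} {u} (parent-adjacent p)

lift : ∀ {d n a} {ns : Vec ℕ d} → a < n → HVertex ns → HVertex (n ∷ ns)
lift p (xs , ps) = _ ∷ xs , p ∷ ps

lift-tree : ∀ {d n a} {ns : Vec ℕ d} (p : a < n) {u v}
  → Tree ns u v → Tree (n ∷ ns) (lift p u) (lift p v)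
lift-tree p (inj₁ q) = inj₁ (keep-head q)
lift-tree p (inj₂ q) = inj₂ (keep-head q)

lift-walk : ∀ {d n a} {ns : Vec ℕ d} (p : a < n) {u v k}
  → Walk (Tree ns) u v k → Walk (Tree (n ∷ ns)) (lift p u) (lift p v) k
lift-walk {ns = ns} p = mapʷ (lift p) (λ {u} {v} → lift-tree {ns = ns} p {u} {v})

to-root : ∀ {d} {ns : Vec ℕ d} (u r : HVertex ns) → proj₁ r ≡ zeros
  → Walk (Tree ns) u r (weight (proj₁ u))
to-root {ns = []} ([] , []) ([] , []) refl = nil
to-root {ns = n ∷ ns} (zero ∷ xs , p ∷ ps) (_ ∷ _ , q ∷ qs) refl
  with refl ← <-irrelevant p q =
  lift-walk p (to-root {ns = ns} (xs , ps) (zeros , qs) refl)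
to-root {ns = n ∷ ns} (suc a ∷ xs , p ∷ ps) (_ ∷ _ , q ∷ qs) refl =
  snocʷ (lift-walk p (to-root {ns = ns} (xs , ps) (zeros , qs) refl)) (inj₁ clear-head)

-- The root is a vertex as soon as the graph has any vertex.
zeros-in-bounds : ∀ {d} {xs ns : Vec ℕ d} → Pointwise _<_ xs ns → Pointwise _<_ (zeros {d}) ns
zeros-in-bounds []       = []
zeros-in-bounds (p ∷ ps) = ≤-trans (s≤s z≤n) p ∷ zeros-in-bounds ps

root-of : ∀ {d} {ns : Vec ℕ d} → HVertex ns → HVertex ns
root-of (_ , ps) = zeros , zeros-in-bounds ps

tree-spanning : ∀ {d} (ns : Vec ℕ d) → SpanningTree (HAdj ns) (Tree ns)
tree-spanning ns = record
  { sub       = λ {u} {v} → tree-sub ns {u} {v}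
  ; symmetric = λ {u} {v} → tree-sym ns {u} {v}
  ; connected = λ u v → _ , walk-via (λ {x} {y} → tree-sym ns {x} {y})
                  (to-root u (root-of u) refl) (to-root v (root-of u) refl)
  ; acyclic   = tree-acyclic ns
  }

-- 4. Stretch of the Hamming tree

lift-dist : ∀ {d n a} {ns : Vec ℕ d} (p : a < n) {u v k}
  → DistAtMost (Tree ns) u v k → DistAtMost (Tree (n ∷ ns)) (lift p u) (lift p v) k
lift-dist {ns = ns} p = map-dist (lift p) (λ {u} {v} → lift-tree {ns = ns} p {u} {v})

vec-ext : ∀ {d} {xs ys : Vec ℕ d} → (∀ i → lookup xs i ≡ lookup ys i) → xs ≡ ys
vec-ext same = Extensional.Pointwise-≡⇒≡ (Extensional.ext same)

-- An edge of
-- K_n × K_{n_2} × ⋯ × K_{n_d} changes either a later coordinate (then it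
-- is a lifted edge of K_{n_2} × ⋯ × K_{n_d}) or the first one (then it is
-- closed up through the root, with length weight u + weight v).
stretch-cons : ∀ {d n k} {ns : Vec ℕ d}
  → (∀ {a b} (xs : Vec ℕ d) → a < n → b < n → a ≢ b → weight (a ∷ xs) + weight (b ∷ xs) ≤ k)
  → StretchAtMost (HAdj ns) (Tree ns) k
  → StretchAtMost (HAdj (n ∷ ns)) (Tree (n ∷ ns)) k
stretch-cons {ns = ns} first-coord _
  u@(a ∷ xs , p ∷ ps) v@(b ∷ ys , q ∷ qs) (fzero , a≢b , same)
  with refl ← vec-ext {xs = xs} {ys} (λ i → same (fsuc i) λ ())
  = dist-weaken (first-coord xs p q a≢b)
      (dist-via (λ {x} {y} → tree-sym (_ ∷ ns) {x} {y})
        (to-root u (root-of u) refl) (to-root v (root-of u) refl))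
stretch-cons {ns = ns} _ later-coords
  (a ∷ xs , p ∷ ps) (b ∷ ys , q ∷ qs) (fsuc i , xi≢yi , same)
  with refl ← same fzero (λ ())
  with refl ← <-irrelevant p q
  = lift-dist {ns = ns} p (later-coords (xs , ps) (ys , qs)
      (i , xi≢yi , λ j j≢i → same (fsuc j) (j≢i ∘ fsuc-injective)))

2*-as-sum : ∀ m → 2 * m ≡ m + m
2*-as-sum m = cong (m +_) (+-identityʳ m)

stretch-2d : ∀ {d} (ns : Vec ℕ d) → StretchAtMost (HAdj ns) (Tree ns) (2 * d)
stretch-2d []                 _ _ (() , _)
stretch-2d {suc d} (n ∷ ns) =
  stretch-cons first-coord (stretch-weaken (*-monoʳ-≤ 2 (n≤1+n d)) (stretch-2d ns))
  where
  first-coord : ∀ {a b} (xs : Vec ℕ d) → a < n → b < n → a ≢ b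
    → weight (a ∷ xs) + weight (b ∷ xs) ≤ 2 * suc d
  first-coord {a} {b} xs _ _ _ = begin
    weight (a ∷ xs) + weight (b ∷ xs) ≤⟨ +-mono-≤ (weight≤length (a ∷ xs)) (weight≤length (b ∷ xs)) ⟩
    suc d + suc d                     ≡⟨ 2*-as-sum (suc d) ⟨
    2 * suc d                         ∎
    where open ≤-Reasoning

-- When n_1 = 2 an edge in the first coordinate joins (0,x) and (1,x), whose
-- weights sum to at most d + (d + 1), so σ(G, Tree) ≤ 2d - 1.
stretch-binary : ∀ {d} (ns : Vec ℕ d) → StretchAtMost (HAdj (2 ∷ ns)) (Tree (2 ∷ ns)) (2 * suc d ∸ 1)
stretch-binary {d} ns =
  stretch-weaken (≤-reflexive (cong (_∸ 1) (sym (2*-as-sum (suc d)))))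
    (stretch-cons first-coord (stretch-weaken later-bound (stretch-2d ns)))
  where
  later-bound : 2 * d ≤ d + suc d
  later-bound = subst (_≤ d + suc d) (sym (2*-as-sum d)) (+-monoʳ-≤ d (n≤1+n d))

  first-coord : ∀ {a b} (xs : Vec ℕ d) → a < 2 → b < 2 → a ≢ b
    → weight (a ∷ xs) + weight (b ∷ xs) ≤ d + suc d
  first-coord {0} {0} _ _ _ 0≢0 = ⊥-elim (0≢0 refl)
  first-coord {0} {1} xs _ _ _   = +-mono-≤ (weight≤length xs) (s≤s (weight≤length xs))
  first-coord {1} {0} xs _ _ _   =
    subst (_≤ d + suc d) (+-comm (weight xs) (suc (weight xs)))
      (+-mono-≤ (weight≤length xs) (s≤s (weight≤length xs)))
  first-coord {1} {1} _ _ _ 1≢1 = ⊥-elim (1≢1 refl)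
  first-coord {suc (suc _)} _ (s≤s (s≤s ())) _ _
  first-coord {_} {suc (suc _)} _ _ (s≤s (s≤s ())) _

lemma3p1 : (d′ : ℕ) (ns : Vec ℕ (suc d′))
    → 2 ≤ lookup ns fzero
    → (∀ i j → i ≤ᶠ j → lookup ns i ≤ lookup ns j)
    → (lookup ns fzero ≡ 2 → TreeStretchAtMost (HAdj ns) (2 * suc d′ ∸ 1))
    × (3 ≤ lookup ns fzero → TreeStretchAtMost (HAdj ns) (2 * suc d′))
lemma3p1 d′ (n ∷ ns) _ _ =
    (λ { refl → Tree (2 ∷ ns) , tree-spanning (2 ∷ ns) , stretch-binary ns })
  , (λ _ → Tree (n ∷ ns) , tree-spanning (n ∷ ns) , stretch-2d (n ∷ ns))
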